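{- Let $G$ be an amenable graph whose anisotropic components in $C(G)$ are $A_1,\dots,A_k$, and for each $i$ let $G_i=G[\bigcup_{X\in A_i}X]$. For $S\subseteq V(G)$ let $S_i=S\cap V(G_i)$. Then $S$ is a fixing set of $G$ if and only if $S_i$ is a $\mathcal{P}_G$-fixing set of $G_i$ for every $i=1,\dots,k$. Consequently $Fix(G)=\sum_{i=1}^k Fix(G_i,\mathcal{P}_G)$.
   Context: Color refinement on a graph $K$: start with $\mathcal{P}_0=\{V(K)\}$; given $\mathcal{P}_{i-1}$, two vertices lie in the same cell of $\mathcal{P}_i$ iff they lie in the same cell of $\mathcal{P}_{i-1}$ and have the same number of neighbors in every cell of $\mathcal{P}_{i-1}$; stop when stable. The result for $K=G$ is the stable partition $\mathcal{P}_G$. The isomorphism test for $G,H$ runs color refinement on $G\cup H$ and answers "isomorphic" iff each cell of the stable partition of $G\cup H$ has equally many vertices from $G$ and from $H$; $G$ is amenable if this test is correct for every $H$. The cell graph $C(G)$ is the complete graph on the vertex set $\mathcal{P}_G$. For distinct cells $X,Y$, the pair $XY$ is isotropic if the bipartite graph $G[X,Y]$ (vertices $X\cup Y$, edges of $G$ between $X$ and $Y$) is empty or complete bipartite, and anisotropic otherwise. The anisotropic components are the connected components of the graph on $\mathcal{P}_G$ whose edges are the anisotropic pairs. A set $S\subseteq V(G)$ is a fixing set of $G$ if the only automorphism fixing every vertex of $S$ is the identity; $Fix(G)$ is the minimum size of a fixing set. For a partition $\mathcal{P}$ and a graph $F$ with $V(F)$ contained in its ground set, $Aut(F,\mathcal{P})$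 is the set of automorphisms of $F$ mapping each vertex into its own cell of $\mathcal{P}$; $S\subseteq V(F)$ is a $\mathcal{P}$-fixing set of $F$ if the only element of $Aut(F,\mathcal{P})$ fixing every vertex of $S$ is the identity, and $Fix(F,\mathcal{P})$ is the minimum size of such a set. -}

module Defs where

open import Data.Nat using (ℕ; zero; suc; _+_; _≤_; _≡ᵇ_)
open import Data.Bool using (Bool; true; false; _∧_; if_then_else_; T)
open import Data.Fin using (Fin; zero; suc; splitAt; _↑ˡ_; _↑ʳ_)
open import Data.Fin.Subset using (Subset; _∈_; ∣_∣)
open import Data.Sum using (_⊎_; inj₁; inj₂)
open import Data.Product using (Σ; Σ-syntax; ∃; ∃-syntax; _×_; _,_)
open import Data.Empty using (⊥)
open import Relation.Nullary using (¬_)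
open import Relation.Binary.PropositionalEquality using (_≡_)
open import Function.Bundles using (_↔_; Inverse)

Adj : ℕ → Set
Adj n = Fin n → Fin n → Bool

record Graph (n : ℕ) : Set where
  field
    adj    : Adj n
    sym    : ∀ u v → adj u v ≡ adj v u
    irrefl : ∀ u → adj u u ≡ false
open Graph public

count : ∀ {n} → (Fin n → Bool) → ℕ
count {zero}  p = 0
count {suc n} p = (if p zero then 1 else 0) + count (λ x → p (suc x))

allFin : ∀ {n} → (Fin n → Bool) → Bool
allFin {zero}  p = true
allFin {suc n} p = p zero ∧ allFin (λ x → p (suc x))

sumFin : ∀ {k} → (Fin k → ℕ) → ℕ
sumFin {zero}  f = 0
sumFin {suc k} f = f zero + sumFin (λ i → f (suc i))

-- Color refinement.  A partition of Fin n is represented by its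
-- "same cell" relation (Boolean-valued); the cell of w is {x | R x w}.

Partition : ℕ → Set
Partition n = Fin n → Fin n → Bool

P₀ : ∀ {n} → Partition n
P₀ u v = true

refine : ∀ {n} → Adj n → Partition n → Partition n
refine a R u v =
  R u v ∧ allFin (λ w → count (λ x → a u x ∧ R x w) ≡ᵇ count (λ x → a v x ∧ R x w))

iterate : ∀ {n} → Adj n → ℕ → Partition n
iterate a zero    = P₀
iterate a (suc i) = refine a (iterate a i)

-- The stable partition: on n vertices the refinement stabilises after
-- at most n steps and stays constant afterwards, so P_n is the result.
stable : ∀ {n} → Adj n → Partition n
stable {n} a = iterate a n

𝒫 : ∀ {n} → Graph n → Partition n
𝒫 G = stable (adj G)

unionAdj : ∀ {n m} → Graph n → Graph m → Adj (n + m)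
unionAdj {n} G H u v with splitAt n u | splitAt n v
... | inj₁ a | inj₁ b = adj G a b
... | inj₂ a | inj₂ b = adj H a b
... | _      | _      = false

CRTest : ∀ {n m} → Graph n → Graph m → Set
CRTest {n} {m} G H =
  ∀ (w : Fin (n + m)) →
    count (λ x → R (x ↑ˡ m) w) ≡ count (λ y → R (n ↑ʳ y) w)
  where R = stable (unionAdj G H)

Isomorphic : ∀ {n m} → Graph n → Graph m → Set
Isomorphic {n} {m} G H =
  Σ[ f ∈ Fin n ↔ Fin m ] (∀ u v → adj H (Inverse.to f u) (Inverse.to f v) ≡ adj G u v)

Amenable : ∀ {n} → Graph n → Set
Amenable G = ∀ m (H : Graph m) → (CRTest G H → Isomorphic G H) × (Isomorphic G H → CRTest G H)

SameCell : ∀ {n} → Graph n → Fin n → Fin n → Set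
SameCell G u v = T (𝒫 G u v)

-- the pair (cell of u, cell of v) is anisotropic: the cells are distinct
-- and G[X,Y] is neither empty nor complete bipartite
Anisotropic : ∀ {n} → Graph n → Fin n → Fin n → Set
Anisotropic G u v =
  ¬ SameCell G u v
  × (∃[ x ] ∃[ y ] (SameCell G x u × SameCell G y v × adj G x y ≡ true))
  × (∃[ x ] ∃[ y ] (SameCell G x u × SameCell G y v × adj G x y ≡ false))

-- Conn G r v : the cell of v lies in the anisotropic component of the cell of r
data Conn {n} (G : Graph n) (r : Fin n) : Fin n → Set where
  here : ∀ {v} → SameCell G r v → Conn G r v
  step : ∀ {w v} → Conn G r w → Anisotropic G w v → Conn G r v

-- vertex set of G_r := G[⋃ of the cells of the anisotropic component of r]
Comp : ∀ {n} → Graph n → Fin n → Fin n → Set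
Comp G r v = Conn G r v

IsFixingSet : ∀ {n} → Graph n → Subset n → Set
IsFixingSet {n} G S =
  ∀ (f : Fin n ↔ Fin n) →
    (∀ u v → adj G (Inverse.to f u) (Inverse.to f v) ≡ adj G u v) →
    (∀ s → s ∈ S → Inverse.to f s ≡ s) →
    ∀ v → Inverse.to f v ≡ v

-- Values of f outside U are irrelevant.
record IsAutOnP {n} (G : Graph n) (U : Fin n → Set) (R : Partition n)
                (f : Fin n → Fin n) : Set where
  field
    maps-into : ∀ v → U v → U (f v)
    injective : ∀ u v → U u → U v → f u ≡ f v → u ≡ v
    surjective : ∀ v → U v → ∃[ u ] (U u × f u ≡ v)
    preserves-adj : ∀ u v → U u → U v → adj G (f u) (f v) ≡ adj G u v
    cell-preserving : ∀ v → U v → T (R (f v) v)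

-- S ∩ U is an R-fixing set of G[U]
IsFixingSetP : ∀ {n} → Graph n → (Fin n → Set) → Partition n → Subset n → Set
IsFixingSetP {n} G U R S =
  ∀ (f : Fin n → Fin n) → IsAutOnP G U R f →
    (∀ s → U s → s ∈ S → f s ≡ s) →
    ∀ v → U v → f v ≡ v

IsMinSize : ∀ {n} → (Subset n → Set) → ℕ → Set
IsMinSize Fixes k =
  (Σ[ S ∈ _ ] (Fixes S × ∣ S ∣ ≡ k)) × (∀ S → Fixes S → k ≤ ∣ S ∣)

IsFix : ∀ {n} → Graph n → ℕ → Set
IsFix G = IsMinSize (IsFixingSet G)

IsFixP : ∀ {n} → Graph n → (Fin n → Set) → Partition n → ℕ → Set
IsFixP G U R = IsMinSize (IsFixingSetP G U R)

EnumeratesComponents : ∀ {n k} → Graph n → (Fin k → Fin n) → Set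
EnumeratesComponents G r =
  (∀ v → ∃[ i ] Conn G (r i) v) × (∀ i j → Conn G (r i) (r j) → i ≡ j)

-- An automorphism of G preserves every cell of the stable colouring, so it restricts to an
-- element of Aut(G_i, 𝒫_G) on each anisotropic component.  Conversely, an element of
-- Aut(G_i, 𝒫_G) extended by the identity is an automorphism of G: every pair of cells lying in
-- different components is isotropic, so the adjacency between a vertex of G_i and a vertex outside
-- depends only on the cell of the former, which the map preserves.  Hence S fixes G iff each S_i
-- fixes its G_i, and a minimum fixing set of G is the union of minimum ones of the components.
module Submission where

open import Defs hiding (sym)
open import Data.Nat using (ℕ; zero; suc; _+_; _≤_; z≤n)
import Data.Nat.Properties as ℕ
open import Data.Bool using (Bool; true; false; _∧_; if_then_else_; T)
open import Data.Bool.Properties as Bool using (T-∧; T-≡)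
open import Data.Fin using (Fin; zero; suc; _≟_)
import Data.Fin.Properties as Fin
open import Data.Fin.Subset using (Subset; _∈_; _⊆_; _⊂_; _∩_; ∣_∣)
open import Data.Fin.Subset.Properties
  using (_∈?_; _⊂?_; ∣p∣≤n; p⊂q⇒∣p∣<∣q∣; p⊆q⇒∣p∣≤∣q∣; x∈p∩q⁺; x∈p∩q⁻)
open import Data.Fin.Permutation using (Permutation′; _⟨$⟩ʳ_; _⟨$⟩ˡ_; inverseʳ)
open import Data.Vec using ([]; _∷_; lookup; tabulate)
import Data.Vec.Properties as Vec
open import Data.Product using (∃; ∃-syntax; _×_; _,_; proj₁; proj₂)
open import Data.Sum using (_⊎_; inj₁; inj₂)
open import Data.Unit using (tt)
open import Data.Empty using (⊥-elim)
open import Function using (_∘_)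
open import Function.Bundles using (_⇔_; mk⇔; mk↔ₛ′; Injection; Equivalence)
open import Function.Properties.Inverse using (↔⇒↣)
import Function.Properties.Equivalence as ⇔
open import Level using (_⊔_)
open import Relation.Nullary using (¬_; Dec; yes; no; contradiction)
open import Relation.Nullary.Decidable using (⌊_⌋; toWitness; fromWitness; map′; ¬?; _×-dec_; _⊎-dec_)
open import Relation.Nullary.Decidable.Core using (T?)
open import Relation.Unary using (Pred; Decidable)
import Relation.Binary as B
open import Relation.Binary.PropositionalEquality
import Algebra.Properties.CommutativeMonoid.Sum as Sum

open Sum ℕ.+-0-commutativeMonoid using (sum; sum-cong-≗; sum-permute; ∑-comm; sum-replicate-zero)

T-extensional : ∀ {a b} → (T a → T b) → (T b → T a) → a ≡ b
T-extensional {false} {false} _ _ = refl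
T-extensional {false} {true}  _ g = ⊥-elim (g tt)
T-extensional {true}  {false} f _ = ⊥-elim (f tt)
T-extensional {true}  {true}  _ _ = refl

allFin⁺ : ∀ {n} {p : Fin n → Bool} → (∀ x → T (p x)) → T (allFin p)
allFin⁺ {zero}  h = tt
allFin⁺ {suc n} h = Equivalence.from T-∧ (h zero , allFin⁺ (h ∘ suc))

allFin⁻ : ∀ {n} {p : Fin n → Bool} → T (allFin p) → ∀ x → T (p x)
allFin⁻ {suc n} {p} t zero    = proj₁ (Equivalence.to (T-∧ {p zero}) t)
allFin⁻ {suc n} {p} t (suc x) = allFin⁻ (proj₂ (Equivalence.to (T-∧ {p zero}) t)) x

indicator : Bool → ℕ
indicator b = if b then 1 else 0

sumFin≡sum : ∀ {k} (f : Fin k → ℕ) → sumFin f ≡ sum f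
sumFin≡sum {zero}  f = refl
sumFin≡sum {suc k} f = cong (f zero +_) (sumFin≡sum (f ∘ suc))

count≡sum : ∀ {n} (p : Fin n → Bool) → count p ≡ sum (indicator ∘ p)
count≡sum {zero}  p = refl
count≡sum {suc n} p = cong (indicator (p zero) +_) (count≡sum (p ∘ suc))

count-cong : ∀ {n} {p q : Fin n → Bool} → (∀ x → p x ≡ q x) → count p ≡ count q
count-cong {p = p} {q} p≗q = begin
  count p               ≡⟨ count≡sum p ⟩
  sum (indicator ∘ p)   ≡⟨ sum-cong-≗ (cong indicator ∘ p≗q) ⟩
  sum (indicator ∘ q)   ≡⟨ count≡sum q ⟨
  count q               ∎
  where open ≡-Reasoning

count-permute : ∀ {n} (π : Permutation′ n) (p : Fin n → Bool) → count p ≡ count (p ∘ (π ⟨$⟩ʳ_))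
count-permute π p = begin
  count p                            ≡⟨ count≡sum p ⟩
  sum (indicator ∘ p)                ≡⟨ sum-permute (indicator ∘ p) π ⟩
  sum (indicator ∘ p ∘ (π ⟨$⟩ʳ_))    ≡⟨ count≡sum (p ∘ (π ⟨$⟩ʳ_)) ⟨
  count (p ∘ (π ⟨$⟩ʳ_))              ∎
  where open ≡-Reasoning

∑-indicator-≟ : ∀ {k} (j : Fin k) → sum (λ i → indicator ⌊ j ≟ i ⌋) ≡ 1
∑-indicator-≟ {suc k} zero    = cong suc (sum-replicate-zero k)
∑-indicator-≟ {suc k} (suc j) = trans (sum-cong-≗ suc≟suc) (∑-indicator-≟ j)
  where
  suc≟suc : ∀ i → indicator ⌊ suc j ≟ suc i ⌋ ≡ indicator ⌊ j ≟ i ⌋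
  suc≟suc i with j ≟ i
  ... | yes _ = refl
  ... | no  _ = refl

count-partition : ∀ {n k} (c : Fin n → Fin k) (p : Fin n → Bool) →
                  count p ≡ sumFin (λ i → count (λ v → p v ∧ ⌊ c v ≟ i ⌋))
count-partition {k = k} c p = begin
  count p                                                   ≡⟨ count≡sum p ⟩
  sum (indicator ∘ p)                                       ≡⟨ sum-cong-≗ split ⟨
  sum (λ v → sum (λ i → indicator (p v ∧ ⌊ c v ≟ i ⌋)))     ≡⟨ ∑-comm (λ v i → indicator (p v ∧ ⌊ c v ≟ i ⌋)) ⟩
  sum (λ i → sum (λ v → indicator (p v ∧ ⌊ c v ≟ i ⌋)))     ≡⟨ sum-cong-≗ (λ i → count≡sum (λ v → p v ∧ ⌊ c v ≟ i ⌋)) ⟨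
  sum (λ i → count (λ v → p v ∧ ⌊ c v ≟ i ⌋))               ≡⟨ sumFin≡sum (λ i → count (λ v → p v ∧ ⌊ c v ≟ i ⌋)) ⟨
  sumFin (λ i → count (λ v → p v ∧ ⌊ c v ≟ i ⌋))            ∎
  where
  open ≡-Reasoning
  split : ∀ v → sum (λ i → indicator (p v ∧ ⌊ c v ≟ i ⌋)) ≡ indicator (p v)
  split v with p v
  ... | true  = ∑-indicator-≟ (c v)
  ... | false = sum-replicate-zero k

cellDegree : ∀ {n} → Adj n → Partition n → Fin n → Fin n → ℕ
cellDegree a R u w = count (λ x → a u x ∧ R x w)

module _ {n} (a : Adj n) (R : Partition n) {u v : Fin n} where

  refine⁺ : T (R u v) → (∀ w → cellDegree a R u w ≡ cellDegree a R v w) → T (refine a R u v)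
  refine⁺ u~v deg≡ = Equivalence.from T-∧ (u~v , allFin⁺ (λ w → ℕ.≡⇒≡ᵇ _ _ (deg≡ w)))

  refine⁻ : T (refine a R u v) → T (R u v) × (∀ w → cellDegree a R u w ≡ cellDegree a R v w)
  refine⁻ t with Equivalence.to (T-∧ {R u v}) t
  ... | u~v , degs = u~v , λ w → ℕ.≡ᵇ⇒≡ _ _ (allFin⁻ degs w)

module _ {n} (a : Adj n) where

  iterate-refl : ∀ i u → T (iterate a i u u)
  iterate-refl zero    u = tt
  iterate-refl (suc i) u = refine⁺ a _ (iterate-refl i u) (λ _ → refl)

  iterate-sym : ∀ i {u v} → T (iterate a i u v) → T (iterate a i v u)
  iterate-sym zero    _ = tt
  iterate-sym (suc i) t with refine⁻ a _ t
  ... | u~v , deg≡ = refine⁺ a _ (iterate-sym i u~v) (λ w → sym (deg≡ w))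

  iterate-trans : ∀ i {u v w} → T (iterate a i u v) → T (iterate a i v w) → T (iterate a i u w)
  iterate-trans zero    _ _ = tt
  iterate-trans (suc i) s t with refine⁻ a _ s | refine⁻ a _ t
  ... | u~v , deg≡ | v~w , deg≡′ = refine⁺ a _ (iterate-trans i u~v v~w) (λ x → trans (deg≡ x) (deg≡′ x))

  automorphism-preserves-iterate : (π : Permutation′ n) → (∀ u v → a (π ⟨$⟩ʳ u) (π ⟨$⟩ʳ v) ≡ a u v) →
                         ∀ i v → T (iterate a i (π ⟨$⟩ʳ v) v)
  automorphism-preserves-iterate π hom zero    v = tt
  automorphism-preserves-iterate π hom (suc i) v = refine⁺ a R (automorphism-preserves-iterate π hom i v) λ w → begin
    count (λ x → a (π′ v) x ∧ R x w)              ≡⟨ count-permute π _ ⟩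
    count (λ y → a (π′ v) (π′ y) ∧ R (π′ y) w)    ≡⟨ count-cong (λ y → cong₂ _∧_ (hom v y) (cell-invariant y w)) ⟩
    count (λ y → a v y ∧ R y w)                   ∎
    where
    open ≡-Reasoning
    R = iterate a i
    π′ = π ⟨$⟩ʳ_
    cell-invariant : ∀ y w → R (π′ y) w ≡ R y w
    cell-invariant y w = T-extensional
      (iterate-trans i (iterate-sym i (automorphism-preserves-iterate π hom i y)))
      (iterate-trans i (automorphism-preserves-iterate π hom i y))

fromDec : ∀ {n ℓ} {P : Pred (Fin n) ℓ} → Decidable P → Subset n
fromDec P? = tabulate (⌊_⌋ ∘ P?)

∈-fromDec : ∀ {n ℓ} {P : Pred (Fin n) ℓ} (P? : Decidable P) {x} → x ∈ fromDec P? ⇔ P x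
∈-fromDec P? {x} = mk⇔
  (λ x∈ → toWitness (Equivalence.from T-≡ (trans (sym (Vec.lookup∘tabulate _ x)) (Vec.[]=⇒lookup x∈))))
  (λ Px → Vec.lookup⇒[]= x _ (trans (Vec.lookup∘tabulate _ x) (Equivalence.to T-≡ (fromWitness Px))))

⊆∧⊄⇒⊇ : ∀ {n} {p q : Subset n} → p ⊆ q → ¬ p ⊂ q → q ⊆ p
⊆∧⊄⇒⊇ {p = p} p⊆q p⊄q {x} x∈q with x ∈? p
... | yes x∈p = x∈p
... | no  x∉p = contradiction ((λ {y} → p⊆q {y}) , x , x∈q , x∉p) p⊄q

data Reachable {n a ℓ} (Source : Pred (Fin n) a) (Edge : B.Rel (Fin n) ℓ) : Pred (Fin n) (a ⊔ ℓ) where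
  source : ∀ {v} → Source v → Reachable Source Edge v
  step   : ∀ {w v} → Reachable Source Edge w → Edge w v → Reachable Source Edge v

module _ {n a ℓ} {Source : Pred (Fin n) a} {Edge : B.Rel (Fin n) ℓ}
         (source? : Decidable Source) (edge? : B.Decidable Edge) where

  layer : ℕ → Subset n
  layer zero    = fromDec source?
  layer (suc i) = fromDec (λ v → v ∈? layer i ⊎-dec Fin.any? (λ w → w ∈? layer i ×-dec edge? w v))

  private
    ∈-layer⁺ : ∀ i {v} → v ∈ layer i ⊎ ∃ (λ w → w ∈ layer i × Edge w v) → v ∈ layer (suc i)
    ∈-layer⁺ i = Equivalence.from (∈-fromDec _)

    ∈-layer⁻ : ∀ i {v} → v ∈ layer (suc i) → v ∈ layer i ⊎ ∃ (λ w → w ∈ layer i × Edge w v)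
    ∈-layer⁻ i = Equivalence.to (∈-fromDec _)

  layer-⊆-suc : ∀ i → layer i ⊆ layer (suc i)
  layer-⊆-suc i = ∈-layer⁺ i ∘ inj₁

  layer-mono : ∀ i j → layer i ⊆ layer j → layer (suc i) ⊆ layer (suc j)
  layer-mono i j i⊆j x∈ with ∈-layer⁻ i x∈
  ... | inj₁ x∈i             = ∈-layer⁺ j (inj₁ (i⊆j x∈i))
  ... | inj₂ (w , w∈i , w→x) = ∈-layer⁺ j (inj₂ (w , i⊆j w∈i , w→x))

  layer₀-⊆ : ∀ j → layer 0 ⊆ layer j
  layer₀-⊆ zero    = λ x∈ → x∈
  layer₀-⊆ (suc j) = layer-⊆-suc j ∘ layer₀-⊆ j

  layer-sound : ∀ i {v} → v ∈ layer i → Reachable Source Edge v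
  layer-sound zero    v∈ = source (Equivalence.to (∈-fromDec source?) v∈)
  layer-sound (suc i) v∈ with ∈-layer⁻ i v∈
  ... | inj₁ v∈i             = layer-sound i v∈i
  ... | inj₂ (w , w∈i , w→v) = step (layer-sound i w∈i) w→v

  layer-complete : ∀ {v} → Reachable Source Edge v → ∃ λ i → v ∈ layer i
  layer-complete (source s) = 0 , Equivalence.from (∈-fromDec source?) s
  layer-complete (step r e) with layer-complete r
  ... | i , w∈i = suc i , ∈-layer⁺ i (inj₂ (_ , w∈i , e))

  -- A layer either repeats or is strictly larger than its predecessor; there is room for only n strict increases.
  layers-saturate : ∃ λ j → layer (suc j) ⊆ layer j
  layers-saturate with growth (suc n)
    where
    growth : ∀ i → (∃ λ j → layer (suc j) ⊆ layer j) ⊎ i ≤ ∣ layer i ∣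
    growth zero = inj₂ z≤n
    growth (suc i) with growth i
    ... | inj₁ saturated = inj₁ saturated
    ... | inj₂ i≤ with layer i ⊂? layer (suc i)
    ...   | yes i⊂ = inj₂ (ℕ.≤-<-trans i≤ (p⊂q⇒∣p∣<∣q∣ i⊂))
    ...   | no  i⊄ = inj₁ (i , ⊆∧⊄⇒⊇ (layer-⊆-suc i) i⊄)
  ... | inj₁ saturated = saturated
  ... | inj₂ n<        = contradiction (∣p∣≤n (layer (suc n))) (ℕ.<⇒≱ n<)

  reachable? : Decidable (Reachable Source Edge)
  reachable? v with layers-saturate
  ... | j , saturated with v ∈? layer j
  ...   | yes v∈ = yes (layer-sound j v∈)
  ...   | no  v∉ = no λ r → let (i , v∈i) = layer-complete r in v∉ (layer-⊆-saturated i v∈i)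
    where
    layer-⊆-saturated : ∀ i → layer i ⊆ layer j
    layer-⊆-saturated zero    = layer₀-⊆ j
    layer-⊆-saturated (suc i) = saturated ∘ layer-mono i j (layer-⊆-saturated i)

module _ {n} (G : Graph n) where

  sameCell-refl : ∀ u → SameCell G u u
  sameCell-refl = iterate-refl (adj G) n

  sameCell-sym : ∀ {u v} → SameCell G u v → SameCell G v u
  sameCell-sym = iterate-sym (adj G) n

  sameCell-trans : ∀ {u v w} → SameCell G u v → SameCell G v w → SameCell G u w
  sameCell-trans = iterate-trans (adj G) n

  sameCell? : ∀ u v → Dec (SameCell G u v)
  sameCell? u v = T? (𝒫 G u v)

  automorphism-preserves-cells : (π : Permutation′ n) → (∀ u v → adj G (π ⟨$⟩ʳ u) (π ⟨$⟩ʳ v) ≡ adj G u v) →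
                          ∀ v → SameCell G (π ⟨$⟩ʳ v) v
  automorphism-preserves-cells π hom = automorphism-preserves-iterate (adj G) π hom n

  anisotropic-sym : ∀ {u v} → Anisotropic G u v → Anisotropic G v u
  anisotropic-sym (u≁v , (x , y , x~u , y~v , xy) , (x′ , y′ , x′~u , y′~v , x′y′)) =
    u≁v ∘ sameCell-sym ,
    (y , x , y~v , x~u , trans (Graph.sym G y x) xy) ,
    (y′ , x′ , y′~v , x′~u , trans (Graph.sym G y′ x′) x′y′)

  anisotropic-resp : ∀ {u u′ v v′} → SameCell G u u′ → SameCell G v v′ →
                     Anisotropic G u v → Anisotropic G u′ v′
  anisotropic-resp u~u′ v~v′ (u≁v , (x , y , x~u , y~v , xy) , (x′ , y′ , x′~u , y′~v , x′y′)) =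
    (λ u′~v′ → u≁v (sameCell-trans u~u′ (sameCell-trans u′~v′ (sameCell-sym v~v′)))) ,
    (x , y , sameCell-trans x~u u~u′ , sameCell-trans y~v v~v′ , xy) ,
    (x′ , y′ , sameCell-trans x′~u u~u′ , sameCell-trans y′~v v~v′ , x′y′)

  anisotropic? : ∀ u v → Dec (Anisotropic G u v)
  anisotropic? u v = ¬? (sameCell? u v) ×-dec edgeWith? true ×-dec edgeWith? false
    where
    edgeWith? : ∀ b → Dec (∃[ x ] ∃[ y ] (SameCell G x u × SameCell G y v × adj G x y ≡ b))
    edgeWith? b = Fin.any? λ x → Fin.any? λ y →
      sameCell? x u ×-dec sameCell? y v ×-dec adj G x y Bool.≟ b

  conn-resp : ∀ {r v v′} → Conn G r v → SameCell G v v′ → Conn G r v′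
  conn-resp (here r~v)  v~v′ = here (sameCell-trans r~v v~v′)
  conn-resp (step c an) v~v′ = step c (anisotropic-resp (sameCell-refl _) v~v′ an)

  conn-trans : ∀ {r w v} → Conn G r w → Conn G w v → Conn G r v
  conn-trans c (here w~v)   = conn-resp c w~v
  conn-trans c (step c′ an) = step (conn-trans c c′) an

  conn-sym : ∀ {r v} → Conn G r v → Conn G v r
  conn-sym (here r~v)  = here (sameCell-sym r~v)
  conn-sym (step c an) = conn-trans (step (here (sameCell-refl _)) (anisotropic-sym an)) (conn-sym c)

  conn⇔reachable : ∀ {r v} → Conn G r v ⇔ Reachable (SameCell G r) (Anisotropic G) v
  conn⇔reachable = mk⇔ to from
    where
    to : ∀ {r v} → Conn G r v → Reachable (SameCell G r) (Anisotropic G) v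
    to (here r~v)  = source r~v
    to (step c an) = step (to c) an
    from : ∀ {r v} → Reachable (SameCell G r) (Anisotropic G) v → Conn G r v
    from (source r~v) = here r~v
    from (step c an)  = step (from c) an

  conn? : ∀ r → Decidable (Conn G r)
  conn? r v = map′ (Equivalence.from conn⇔reachable) (Equivalence.to conn⇔reachable)
                   (reachable? (sameCell? r) anisotropic? v)

  -- Every cell outside the component of r forms an isotropic pair with each cell inside it.
  adj-outside-component : ∀ {r u v x} → Conn G r u → ¬ Conn G r v → SameCell G x u →
                          adj G x v ≡ adj G u v
  adj-outside-component {r} {u} {v} {x} cu ¬cv x~u with adj G x v in xv | adj G u v in uv
  ... | false | false = refl
  ... | true  | true  = refl
  ... | true  | false = contradiction (step cu (¬cv ∘ conn-resp cu , xv-edge , uv-edge)) ¬cv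
    where
    xv-edge = x , v , x~u , sameCell-refl v , xv
    uv-edge = u , v , sameCell-refl u , sameCell-refl v , uv
  ... | false | true  = contradiction (step cu (¬cv ∘ conn-resp cu , uv-edge , xv-edge)) ¬cv
    where
    xv-edge = x , v , x~u , sameCell-refl v , xv
    uv-edge = u , v , sameCell-refl u , sameCell-refl v , uv

module Extension {n} {G : Graph n} {U : Fin n → Set} {R : Partition n} (U? : Decidable U)
                 {f : Fin n → Fin n} (aut : IsAutOnP G U R f) where
  open IsAutOnP aut

  extend : Fin n → Fin n
  extend x with U? x
  ... | yes _ = f x
  ... | no  _ = x

  retract : Fin n → Fin n
  retract y with U? y
  ... | yes y∈U = proj₁ (surjective y y∈U)
  ... | no  _   = y

  extend-in : ∀ {x} → U x → extend x ≡ f x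
  extend-in {x} x∈U with U? x
  ... | yes _   = refl
  ... | no  x∉U = contradiction x∈U x∉U

  extend-out : ∀ {x} → ¬ U x → extend x ≡ x
  extend-out {x} x∉U with U? x
  ... | yes x∈U = contradiction x∈U x∉U
  ... | no  _   = refl

  retract-in : ∀ {y} → U y → U (retract y) × f (retract y) ≡ y
  retract-in {y} y∈U with U? y
  ... | yes y∈U′ = proj₂ (surjective y y∈U′)
  ... | no  y∉U  = contradiction y∈U y∉U

  retract-out : ∀ {y} → ¬ U y → retract y ≡ y
  retract-out {y} y∉U with U? y
  ... | yes y∈U = contradiction y∈U y∉U
  ... | no  _   = refl

  extend∘retract : ∀ y → extend (retract y) ≡ y
  extend∘retract y with U? y
  ... | yes y∈U = let x∈U , fx≡y = proj₂ (surjective y y∈U) in trans (extend-in x∈U) fx≡y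
  ... | no  y∉U = extend-out y∉U

  retract∘extend : ∀ x → retract (extend x) ≡ x
  retract∘extend x with U? x
  ... | yes x∈U = let r∈U , fr≡fx = retract-in (maps-into x x∈U) in injective _ x r∈U x∈U fr≡fx
  ... | no  x∉U = retract-out x∉U

  extension : Permutation′ n
  extension = mk↔ₛ′ extend retract extend∘retract retract∘extend

  extension-preserves-adj : (∀ u v → U u → ¬ U v → adj G (f u) v ≡ adj G u v) →
                            ∀ u v → adj G (extend u) (extend v) ≡ adj G u v
  extension-preserves-adj boundary u v with U? u | U? v
  ... | yes u∈U | yes v∈U = preserves-adj u v u∈U v∈U
  ... | yes u∈U | no  v∉U = boundary u v u∈U v∉U
  ... | no  u∉U | yes v∈U = trans (Graph.sym G u (f v)) (trans (boundary v u v∈U u∉U) (Graph.sym G v u))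
  ... | no  _   | no  _   = refl

module _ {n} (G : Graph n) where

  automorphism-restricts : ∀ {U : Fin n → Set} → (∀ {u v} → U u → SameCell G u v → U v) →
    (π : Permutation′ n) → (∀ u v → adj G (π ⟨$⟩ʳ u) (π ⟨$⟩ʳ v) ≡ adj G u v) →
    IsAutOnP G U (𝒫 G) (π ⟨$⟩ʳ_)
  automorphism-restricts U-closed π hom = record
    { maps-into       = λ x x∈U → U-closed x∈U (sameCell-sym G (cell x))
    ; injective       = λ x y _ _ → Injection.injective (↔⇒↣ π)
    ; surjective      = λ y y∈U → π ⟨$⟩ˡ y ,
                          U-closed y∈U (subst (λ z → SameCell G z (π ⟨$⟩ˡ y)) (inverseʳ π) (cell (π ⟨$⟩ˡ y))) ,
                          inverseʳ π
    ; preserves-adj   = λ x y _ _ → hom x y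
    ; cell-preserving = λ x _ → cell x
    }
    where
    cell : ∀ x → SameCell G (π ⟨$⟩ʳ x) x
    cell = automorphism-preserves-cells G π hom

  fixingSet⇒fixingSetP : ∀ {S} → IsFixingSet G S → ∀ r → IsFixingSetP G (Comp G r) (𝒫 G) S
  fixingSet⇒fixingSetP {S} fixes r f aut f-fixes v v∈ =
    trans (sym (extend-in v∈)) (fixes extension (extension-preserves-adj boundary) extension-fixes v)
    where
    open Extension (conn? G r) aut
    boundary : ∀ u v → Conn G r u → ¬ Conn G r v → adj G (f u) v ≡ adj G u v
    boundary u v cu ¬cv = adj-outside-component G cu ¬cv (IsAutOnP.cell-preserving aut u cu)
    extension-fixes : ∀ s → s ∈ S → extend s ≡ s
    extension-fixes s s∈S = fixed (conn? G r s)
      where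
      fixed : Dec (Conn G r s) → extend s ≡ s
      fixed (yes s∈) = trans (extend-in s∈) (f-fixes s s∈ s∈S)
      fixed (no  s∉) = extend-out s∉

  fixingSetP⇒fixingSet : ∀ {S} → (∀ r → IsFixingSetP G (Comp G r) (𝒫 G) S) → IsFixingSet G S
  fixingSetP⇒fixingSet fixesᵣ π hom π-fixes v =
    fixesᵣ v (π ⟨$⟩ʳ_) (automorphism-restricts (conn-resp G) π hom) (λ s _ → π-fixes s) v (here (sameCell-refl G v))

sumFin-cong : ∀ {k} {f g : Fin k → ℕ} → (∀ i → f i ≡ g i) → sumFin f ≡ sumFin g
sumFin-cong {zero}  f≗g = refl
sumFin-cong {suc k} f≗g = cong₂ _+_ (f≗g zero) (sumFin-cong (f≗g ∘ suc))

sumFin-mono : ∀ {k} {f g : Fin k → ℕ} → (∀ i → f i ≤ g i) → sumFin f ≤ sumFin g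
sumFin-mono {zero}  f≤g = z≤n
sumFin-mono {suc k} f≤g = ℕ.+-mono-≤ (f≤g zero) (sumFin-mono (f≤g ∘ suc))

∣p∣≡count : ∀ {n} (p : Subset n) → ∣ p ∣ ≡ count (lookup p)
∣p∣≡count []          = refl
∣p∣≡count (true  ∷ p) = cong suc (∣p∣≡count p)
∣p∣≡count (false ∷ p) = ∣p∣≡count p

fiber : ∀ {n k} → (Fin n → Fin k) → Fin k → Subset n
fiber c i = fromDec (λ v → c v ≟ i)

∣p∣≡∑∣p∩fiber∣ : ∀ {n k} (c : Fin n → Fin k) (p : Subset n) → ∣ p ∣ ≡ sumFin (λ i → ∣ p ∩ fiber c i ∣)
∣p∣≡∑∣p∩fiber∣ c p = begin
  ∣ p ∣                                             ≡⟨ ∣p∣≡count p ⟩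
  count (lookup p)                                  ≡⟨ count-partition c (lookup p) ⟩
  sumFin (λ i → count (λ v → lookup p v ∧ ⌊ c v ≟ i ⌋))  ≡⟨ sumFin-cong (λ i → count-∩ i) ⟨
  sumFin (λ i → ∣ p ∩ fiber c i ∣)                  ∎
  where
  open ≡-Reasoning
  count-∩ : ∀ i → ∣ p ∩ fiber c i ∣ ≡ count (λ v → lookup p v ∧ ⌊ c v ≟ i ⌋)
  count-∩ i = trans (∣p∣≡count (p ∩ fiber c i)) (count-cong λ v →
    trans (Vec.lookup-zipWith _∧_ v p (fiber c i)) (cong (lookup p v ∧_) (Vec.lookup∘tabulate _ v)))

module _ {n} {G : Graph n} {R : Partition n} where

  autOnP-resp : ∀ {U U′ : Fin n → Set} {f} → (∀ {x} → U x ⇔ U′ x) → IsAutOnP G U R f → IsAutOnP G U′ R f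
  autOnP-resp {U} {U′} U⇔U′ aut = record
    { maps-into       = λ x x∈ → to (maps-into x (from x∈))
    ; injective       = λ x y x∈ y∈ → injective x y (from x∈) (from y∈)
    ; surjective      = λ y y∈ → let x , x∈ , fx≡y = surjective y (from y∈) in x , to x∈ , fx≡y
    ; preserves-adj   = λ x y x∈ y∈ → preserves-adj x y (from x∈) (from y∈)
    ; cell-preserving = λ x x∈ → cell-preserving x (from x∈)
    }
    where
    open IsAutOnP aut
    to : ∀ {x} → U x → U′ x
    to = Equivalence.to U⇔U′
    from : ∀ {x} → U′ x → U x
    from = Equivalence.from U⇔U′

  fixingSetP-resp : ∀ {U U′ : Fin n → Set} {S} → (∀ {x} → U x ⇔ U′ x) →
                    IsFixingSetP G U R S → IsFixingSetP G U′ R S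
  fixingSetP-resp U⇔U′ fixes f aut f-fixes v v∈ =
    fixes f (autOnP-resp (⇔.sym U⇔U′) aut) (λ s s∈ → f-fixes s (Equivalence.to U⇔U′ s∈)) v
      (Equivalence.from U⇔U′ v∈)

  fixingSetP-⊆ : ∀ {U : Fin n → Set} {S S′ : Subset n} → (∀ {s} → U s → s ∈ S → s ∈ S′) →
                 IsFixingSetP G U R S → IsFixingSetP G U R S′
  fixingSetP-⊆ S⊆S′ fixes f aut f-fixes = fixes f aut (λ s s∈U s∈S → f-fixes s s∈U (S⊆S′ s∈U s∈S))

module _ {n} (G : Graph n) {k} {r : Fin k → Fin n} (enum : EnumeratesComponents G r) where

  component : Fin n → Fin k
  component v = proj₁ (proj₁ enum v)

  conn-component : ∀ v → Conn G (r (component v)) v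
  conn-component v = proj₂ (proj₁ enum v)

  component-unique : ∀ {i v} → Conn G (r i) v → component v ≡ i
  component-unique {i} {v} cv = proj₂ enum _ i (conn-trans G (conn-component v) (conn-sym G cv))

  ∈-fiber-component : ∀ {i v} → Conn G (r i) v → v ∈ fiber component i
  ∈-fiber-component = Equivalence.from (∈-fromDec _) ∘ component-unique

  fixingSet-lowerBound : ∀ {fixᵢ : Fin k → ℕ} → (∀ i → IsFixP G (Comp G (r i)) (𝒫 G) (fixᵢ i)) →
                         ∀ S → IsFixingSet G S → sumFin fixᵢ ≤ ∣ S ∣
  fixingSet-lowerBound {fixᵢ} minimal S fixes = begin
    sumFin fixᵢ                               ≤⟨ sumFin-mono (λ i → proj₂ (minimal i) _ (restriction-fixes i)) ⟩
    sumFin (λ i → ∣ S ∩ fiber component i ∣)  ≡⟨ ∣p∣≡∑∣p∩fiber∣ component S ⟨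
    ∣ S ∣                                     ∎
    where
    open ℕ.≤-Reasoning
    restriction-fixes : ∀ i → IsFixingSetP G (Comp G (r i)) (𝒫 G) (S ∩ fiber component i)
    restriction-fixes i = fixingSetP-⊆ (λ s∈U s∈S → x∈p∩q⁺ (s∈S , ∈-fiber-component s∈U))
                                       (fixingSet⇒fixingSetP G fixes (r i))

  glue : (Fin k → Subset n) → Subset n
  glue Sᵢ = fromDec (λ v → v ∈? Sᵢ (component v))

  glue-fixingSet : ∀ {Sᵢ} → (∀ i → IsFixingSetP G (Comp G (r i)) (𝒫 G) (Sᵢ i)) → IsFixingSet G (glue Sᵢ)
  glue-fixingSet {Sᵢ} fixesᵢ = fixingSetP⇒fixingSet G λ v →
    fixingSetP-resp (same-component v) (fixingSetP-⊆ (∈-glue v) (fixesᵢ (component v)))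
    where
    same-component : ∀ v {x} → Comp G (r (component v)) x ⇔ Comp G v x
    same-component v = mk⇔ (conn-trans G (conn-sym G (conn-component v))) (conn-trans G (conn-component v))
    ∈-glue : ∀ v {s} → Comp G (r (component v)) s → s ∈ Sᵢ (component v) → s ∈ glue Sᵢ
    ∈-glue v {s} s∈U s∈S = Equivalence.from (∈-fromDec _)
      (subst (λ i → s ∈ Sᵢ i) (sym (component-unique s∈U)) s∈S)

  ∣glue∩fiber∣≤ : ∀ Sᵢ i → ∣ glue Sᵢ ∩ fiber component i ∣ ≤ ∣ Sᵢ i ∣
  ∣glue∩fiber∣≤ Sᵢ i = p⊆q⇒∣p∣≤∣q∣ λ {x} x∈ →
    let x∈glue , x∈fiber = x∈p∩q⁻ (glue Sᵢ) (fiber component i) x∈ in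
    subst (λ j → x ∈ Sᵢ j) (Equivalence.to (∈-fromDec _) x∈fiber) (Equivalence.to (∈-fromDec _) x∈glue)

  isFix-sum : ∀ {fixᵢ : Fin k → ℕ} → (∀ i → IsFixP G (Comp G (r i)) (𝒫 G) (fixᵢ i)) → IsFix G (sumFin fixᵢ)
  isFix-sum {fixᵢ} minimal = (S , S-fixes , ℕ.≤-antisym upper (lowerBound S S-fixes)) , lowerBound
    where
    lowerBound : ∀ T → IsFixingSet G T → sumFin fixᵢ ≤ ∣ T ∣
    lowerBound = fixingSet-lowerBound minimal
    Sᵢ : Fin k → Subset n
    Sᵢ i = proj₁ (proj₁ (minimal i))
    S = glue Sᵢ
    S-fixes : IsFixingSet G S
    S-fixes = glue-fixingSet (λ i → proj₁ (proj₂ (proj₁ (minimal i))))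
    upper : ∣ S ∣ ≤ sumFin fixᵢ
    upper = begin
      ∣ S ∣                                      ≡⟨ ∣p∣≡∑∣p∩fiber∣ component S ⟩
      sumFin (λ i → ∣ S ∩ fiber component i ∣)   ≤⟨ sumFin-mono (∣glue∩fiber∣≤ Sᵢ) ⟩
      sumFin (λ i → ∣ Sᵢ i ∣)                    ≡⟨ sumFin-cong (λ i → proj₂ (proj₂ (proj₁ (minimal i)))) ⟩
      sumFin fixᵢ                                ∎
      where open ℕ.≤-Reasoning

theorem11 : ∀ {n} (G : Graph n) → Amenable G →
    (∀ (S : Subset n) →
      IsFixingSet G S ⇔ (∀ (r : Fin n) → IsFixingSetP G (Comp G r) (𝒫 G) S))
    × (∀ k (r : Fin k → Fin n) → EnumeratesComponents G r →
        ∀ (fixᵢ : Fin k → ℕ) → (∀ i → IsFixP G (Comp G (r i)) (𝒫 G) (fixᵢ i)) →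
        IsFix G (sumFin fixᵢ))
theorem11 G _ =
  (λ S → mk⇔ (fixingSet⇒fixingSetP G) (fixingSetP⇒fixingSet G)) ,
  (λ k r enum fixᵢ minimal → isFix-sum G enum minimal)
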